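{- If the length of a shortest odd cycle in a graph $G$ is $l$, then the length of a shortest odd cycle in the Cartesian product $K_2\times G$ is also $l$. -}

module Defs where

open import Data.Nat using (ℕ; zero; suc; _≤_; _<_; _*_)
open import Data.Fin using (Fin; zero; suc; inject₁; fromℕ)
open import Data.Bool using (Bool)
open import Data.Product using (_×_; _,_; Σ; ∃-syntax)
open import Data.Sum using (_⊎_)
open import Relation.Binary.PropositionalEquality using (_≡_; _≢_)
open import Relation.Nullary using (¬_)
open import Function.Definitions using (Injective)

Odd : ℕ → Set
Odd n = ∃[ q ] n ≡ suc (2 * q)

record SimpleGraph (V : Set) : Set₁ where
  field
    Adj     : V → V → Set
    sym     : ∀ {u v} → Adj u v → Adj v u
    irrefl  : ∀ {v} → ¬ Adj v v
open SimpleGraph public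

record Cycle {V : Set} (G : SimpleGraph V) (k : ℕ) : Set where
  field
    m        : ℕ
    len      : k ≡ suc m
    len≥3    : 3 ≤ k
    vert     : Fin (suc m) → V
    distinct : Injective _≡_ _≡_ vert
    step     : (i : Fin m) → Adj G (vert (inject₁ i)) (vert (suc i))
    close    : Adj G (vert (fromℕ m)) (vert zero)

ShortestOddCycleLength : {V : Set} → SimpleGraph V → ℕ → Set
ShortestOddCycleLength G l =
  Odd l × Cycle G l × (∀ k → Odd k → Cycle G k → l ≤ k)

K₂□_ : {V : Set} → SimpleGraph V → SimpleGraph (Bool × V)
Adj (K₂□ G) (a , u) (b , v) = (a ≢ b × u ≡ v) ⊎ (a ≡ b × Adj G u v)
sym (K₂□ G) (Data.Sum.inj₁ (a≢b , u≡v)) =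
  Data.Sum.inj₁ ((λ e → a≢b (Relation.Binary.PropositionalEquality.sym e)) , Relation.Binary.PropositionalEquality.sym u≡v)
sym (K₂□ G) (Data.Sum.inj₂ (a≡b , uv)) =
  Data.Sum.inj₂ (Relation.Binary.PropositionalEquality.sym a≡b , SimpleGraph.sym G uv)
irrefl (K₂□ G) (Data.Sum.inj₁ (a≢a , _)) = a≢a Relation.Binary.PropositionalEquality.refl
irrefl (K₂□ G) (Data.Sum.inj₂ (_ , vv)) = SimpleGraph.irrefl G vv

module Submission where

-- An odd cycle of K₂□G is no shorter than a shortest odd cycle of G, and
-- every cycle of G is also one of K₂□G; hence both graphs have the same odd
-- girth.
--
-- Projecting a closed walk of K₂□G to G gives a closed *lazy* walk of G:
-- every step either follows an edge of G or stays put (a step between the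
-- two layers).  The walk changes layer an even number of times, so a closed
-- walk of odd length projects to a lazy walk with an odd number of moves.
-- The key lemma: a closed lazy walk of length L with an odd number of moves
-- contains an odd cycle of length ≤ L.  By strong induction on L: if some
-- vertex repeats, cutting the walk there gives two shorter closed lazy walks
-- whose numbers of moves add up, so one of them is odd; if no vertex
-- repeats, the walk never stays put and is itself an odd cycle.
--
-- Walks are sequences ℕ → V of which only the first L + 1 entries matter.

open import Defs hiding (sym)
open import Data.Nat using (ℕ; zero; suc; _+_; _*_; _≤_; _<_; z≤n; s≤s; z<s)
open import Data.Nat.Properties
open import Data.Nat.DivMod using (_mod_; n%n≡0; m≤n⇒m%n≡m)
open import Data.Nat.Induction using (<-rec)
open import Algebra.Properties.CommutativeSemigroup +-commutativeSemigroup using (xy∙z≈xz∙y)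
open import Data.Fin using (Fin; zero; suc; toℕ; fromℕ<; inject₁; fromℕ)
open import Data.Fin.Properties using (toℕ-injective; toℕ<n; toℕ-fromℕ<; toℕ-inject₁; toℕ-fromℕ)
  renaming (_≟_ to _≟ᶠ_)
open import Data.Bool using (Bool; true; false; not; _xor_)
open import Data.Bool.Properties
  using (not-involutive; xor-same; xor-assoc; xor-identityʳ; not-distribˡ-xor; not-distribʳ-xor)
open import Data.Product using (_×_; _,_; proj₁; proj₂; ∃-syntax; Σ-syntax)
open import Data.Sum using (_⊎_; inj₁; inj₂)
open import Data.Empty using (⊥-elim)
open import Function using (_∘′_)
open import Relation.Nullary using (Dec; yes; no; ¬_; contradiction)
open import Relation.Binary.Definitions using (DecidableEquality; tri<; tri≈; tri>)
open import Relation.Binary.PropositionalEquality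
open ≡-Reasoning

parity : ℕ → Bool
parity zero = false
parity (suc n) = not (parity n)

parity-odd : ∀ q → parity (suc (2 * q)) ≡ true
parity-odd zero = refl
parity-odd (suc q) = begin
  parity (suc (2 * suc q))         ≡⟨ cong (λ n → parity (suc n)) (*-suc 2 q) ⟩
  not (not (parity (suc (2 * q)))) ≡⟨ not-involutive _ ⟩
  parity (suc (2 * q))             ≡⟨ parity-odd q ⟩
  true                             ∎

Odd⇒parity : ∀ {n} → Odd n → parity n ≡ true
Odd⇒parity (q , refl) = parity-odd q

parity⇒Odd : ∀ n → parity n ≡ true → Odd n
parity⇒Odd zero ()
parity⇒Odd 1 _ = 0 , refl
parity⇒Odd (suc (suc n)) h with parity⇒Odd n (trans (sym (not-involutive (parity n))) h)
... | q , refl = suc q , cong suc (sym (*-suc 2 q))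

xorSum : (ℕ → Bool) → ℕ → Bool
xorSum s zero = false
xorSum s (suc L) = xorSum s L xor s L

xorSum-cong : ∀ {s t} L → (∀ i → i < L → s i ≡ t i) → xorSum s L ≡ xorSum t L
xorSum-cong zero _ = refl
xorSum-cong (suc L) s≡t =
  cong₂ _xor_ (xorSum-cong L (λ i i<L → s≡t i (m<n⇒m<1+n i<L))) (s≡t L (n<1+n L))

xorSum-+ : ∀ s a b → xorSum s (a + b) ≡ xorSum s a xor xorSum (λ k → s (a + k)) b
xorSum-+ s a zero = trans (cong (xorSum s) (+-identityʳ a)) (sym (xor-identityʳ _))
xorSum-+ s a (suc b) = begin
  xorSum s (a + suc b)                                        ≡⟨ cong (xorSum s) (+-suc a b) ⟩
  xorSum s (a + b) xor s (a + b)                              ≡⟨ cong (_xor s (a + b)) (xorSum-+ s a b) ⟩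
  (xorSum s a xor xorSum (λ k → s (a + k)) b) xor s (a + b)   ≡⟨ xor-assoc (xorSum s a) _ _ ⟩
  xorSum s a xor (xorSum (λ k → s (a + k)) b xor s (a + b))   ∎

xorSum-true : ∀ L → xorSum (λ _ → true) L ≡ parity L
xorSum-true zero = refl
xorSum-true (suc L) = begin
  xorSum (λ _ → true) L xor true ≡⟨ cong (_xor true) (xorSum-true L) ⟩
  parity L xor true             ≡⟨ not-distribʳ-xor (parity L) false ⟨
  not (parity L xor false)      ≡⟨ cong not (xor-identityʳ (parity L)) ⟩
  not (parity L)                ∎

xorSum-not : (t : ℕ → Bool) (L : ℕ) → xorSum (λ i → not (t i)) L ≡ parity L xor xorSum t L
xorSum-not t zero = refl
xorSum-not t (suc L) = begin
  xorSum (λ i → not (t i)) L xor not (t L)   ≡⟨ cong (_xor not (t L)) (xorSum-not t L) ⟩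
  (parity L xor xorSum t L) xor not (t L)    ≡⟨ not-distribʳ-xor (parity L xor xorSum t L) (t L) ⟨
  not ((parity L xor xorSum t L) xor t L)    ≡⟨ cong not (xor-assoc (parity L) _ _) ⟩
  not (parity L xor (xorSum t L xor t L))    ≡⟨ not-distribˡ-xor (parity L) _ ⟩
  not (parity L) xor (xorSum t L xor t L)    ∎

xorSum-telescope : (l : ℕ → Bool) (L : ℕ) → xorSum (λ i → l i xor l (suc i)) L ≡ l 0 xor l L
xorSum-telescope l zero = sym (xor-same (l 0))
xorSum-telescope l (suc L) = begin
  xorSum (λ i → l i xor l (suc i)) L xor (l L xor l (suc L)) ≡⟨ cong (_xor (l L xor l (suc L))) (xorSum-telescope l L) ⟩
  (l 0 xor l L) xor (l L xor l (suc L))                      ≡⟨ xor-assoc (l 0) (l L) (l L xor l (suc L)) ⟩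
  l 0 xor (l L xor (l L xor l (suc L)))                      ≡⟨ cong (l 0 xor_) (xor-assoc (l L) (l L) (l (suc L))) ⟨
  l 0 xor ((l L xor l L) xor l (suc L))                      ≡⟨ cong (λ b → l 0 xor (b xor l (suc L))) (xor-same (l L)) ⟩
  l 0 xor l (suc L)                                          ∎

oddSummand : ∀ x y z → (x xor y) xor z ≡ true → y ≡ true ⊎ x xor z ≡ true
oddSummand x true z _ = inj₁ refl
oddSummand x false z h = inj₂ (trans (cong (_xor z) (sym (xor-identityʳ x))) h)

record ClosedWalk {V : Set} (H : SimpleGraph V) (L : ℕ) : Set where
  field
    vertex : ℕ → V
    edge   : ∀ i → i < L → Adj H (vertex i) (vertex (suc i))
    closed : vertex L ≡ vertex 0

InjectiveBelow : {V : Set} → (ℕ → V) → ℕ → Set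
InjectiveBelow f L = ∀ a b → a < L → b < L → f a ≡ f b → a ≡ b

cycle⇒closedWalk : ∀ {V : Set} {H : SimpleGraph V} {k} → Cycle H k → ClosedWalk H k
cycle⇒closedWalk {V} {H} record { m = m ; len = refl ; vert = vert ; step = step ; close = close } =
  record { vertex = vertex ; edge = edge ; closed = cong vert wraps }
  where
    vertex : ℕ → V
    vertex i = vert (i mod suc m)

    toℕ-mod : ∀ {i} → i ≤ m → toℕ (i mod suc m) ≡ i
    toℕ-mod {i} i≤m = trans (toℕ-fromℕ< _) (m≤n⇒m%n≡m i≤m)

    wraps : suc m mod suc m ≡ zero
    wraps = toℕ-injective (trans (toℕ-fromℕ< _) (n%n≡0 (suc m)))

    sameVertex : ∀ {i j} → toℕ i ≡ toℕ j → vert i ≡ vert j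
    sameVertex = cong vert ∘′ toℕ-injective

    edge : ∀ i → i < suc m → Adj H (vertex i) (vertex (suc i))
    edge i i<1+m with m<1+n⇒m<n∨m≡n i<1+m
    ... | inj₁ i<m = subst₂ (Adj H) (sameVertex here) (sameVertex next) (step (fromℕ< i<m))
      where
        here : toℕ (inject₁ (fromℕ< i<m)) ≡ toℕ (i mod suc m)
        here = trans (toℕ-inject₁ _) (trans (toℕ-fromℕ< i<m) (sym (toℕ-mod (<⇒≤ i<m))))
        next : toℕ (suc (fromℕ< i<m)) ≡ toℕ (suc i mod suc m)
        next = trans (cong suc (toℕ-fromℕ< i<m)) (sym (toℕ-mod i<m))
    ... | inj₂ refl = subst₂ (Adj H) (sameVertex last) (cong vert (sym wraps)) close
      where
        last : toℕ (fromℕ i) ≡ toℕ (i mod suc i)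
        last = trans (toℕ-fromℕ i) (sym (toℕ-mod ≤-refl))

closedWalk⇒cycle : ∀ {V : Set} {H : SimpleGraph V} {m} (W : ClosedWalk H (suc m)) →
                   3 ≤ suc m → InjectiveBelow (ClosedWalk.vertex W) (suc m) → Cycle H (suc m)
closedWalk⇒cycle {H = H} {m} W 3≤L distinct = record
  { m = m ; len = refl ; len≥3 = 3≤L
  ; vert = λ i → vertex (toℕ i)
  ; distinct = λ {i} {j} e → toℕ-injective (distinct (toℕ i) (toℕ j) (toℕ<n i) (toℕ<n j) e)
  ; step = λ i → subst (λ a → Adj H (vertex a) (vertex (suc (toℕ i))))
                       (sym (toℕ-inject₁ i)) (edge (toℕ i) (m<n⇒m<1+n (toℕ<n i)))
  ; close = subst (λ a → Adj H (vertex a) (vertex 0))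
                  (sym (toℕ-fromℕ m)) (subst (Adj H (vertex m)) closed (edge m ≤-refl))
  }
  where open ClosedWalk W

LazyStep : {V : Set} → SimpleGraph V → Bool → V → V → Set
LazyStep G true u v = Adj G u v
LazyStep G false u v = u ≡ v

record ClosedLazyWalk {V : Set} (G : SimpleGraph V) (L : ℕ) : Set where
  field
    vertex : ℕ → V
    moves  : ℕ → Bool
    step   : ∀ i → i < L → LazyStep G (moves i) (vertex i) (vertex (suc i))
    closed : vertex L ≡ vertex 0

  moveParity : Bool
  moveParity = xorSum moves L

OddClosedLazyWalk : {V : Set} → SimpleGraph V → ℕ → Set
OddClosedLazyWalk G L = Σ[ w ∈ ClosedLazyWalk G L ] ClosedLazyWalk.moveParity w ≡ true

OddCycleWithin : {V : Set} → SimpleGraph V → ℕ → Set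
OddCycleWithin G L = ∃[ k ] k ≤ L × Odd k × Cycle G k

-- skip a d k is the k-th index of ℕ after removing the block a, …, a + d.
skip : ℕ → ℕ → ℕ → ℕ
skip a d k with k <? a
... | yes _ = k
... | no _ = k + suc d

skip-below : ∀ {a d k} → k < a → skip a d k ≡ k
skip-below {a} {d} {k} k<a with k <? a
... | yes _ = refl
... | no k≮a = contradiction k<a k≮a

skip-above : ∀ {a d k} → ¬ k < a → skip a d k ≡ k + suc d
skip-above {a} {d} {k} k≮a with k <? a
... | yes k<a = contradiction k<a k≮a
... | no _ = refl

skip-start : ∀ {A : Set} (f : ℕ → A) a d → f a ≡ f (a + suc d) → f (skip a d 0) ≡ f 0
skip-start f zero d r = sym r
skip-start f (suc a) d _ = refl

-- A closed lazy walk of length L = a + (d + 1) + (e + 1) that is at the same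
-- vertex at times a and a + d + 1 splits into the loop between these times
-- and the rest of the walk, with that loop excised.
module Cut {V : Set} {G : SimpleGraph V} (a d e : ℕ)
           (w : ClosedLazyWalk G (a + suc d + suc e))
           (repeat : ClosedLazyWalk.vertex w a ≡ ClosedLazyWalk.vertex w (a + suc d)) where
  open ClosedLazyWalk w

  L : ℕ
  L = a + suc d + suc e

  beforeEnd : ∀ {k} → k < a → k < L
  beforeEnd k<a = <-≤-trans k<a (≤-trans (m≤m+n a (suc d)) (m≤m+n (a + suc d) (suc e)))

  loop : ClosedLazyWalk G (suc d)
  loop = record
    { vertex = λ k → vertex (a + k)
    ; moves  = λ k → moves (a + k)
    ; step   = loopStep
    ; closed = trans (sym repeat) (cong vertex (sym (+-identityʳ a)))
    }
    where
      loopStep : ∀ k → k < suc d → LazyStep G (moves (a + k)) (vertex (a + k)) (vertex (a + suc k))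
      loopStep k k≤d = subst (LazyStep G (moves (a + k)) (vertex (a + k)) ∘′ vertex) (sym (+-suc a k))
        (step (a + k) (<-≤-trans (+-monoʳ-< a k≤d) (m≤m+n (a + suc d) (suc e))))

  -- Times ≥ a of the excised walk are shifted by d + 1 in the original walk.
  shifted : ∀ k → a + k + suc d ≡ a + suc d + k
  shifted k = xy∙z≈xz∙y a k (suc d)

  rest : ClosedLazyWalk G (a + suc e)
  rest = record
    { vertex = vertex ∘′ skip a d
    ; moves  = moves ∘′ skip a d
    ; step   = restStep
    ; closed = begin
        vertex (skip a d (a + suc e)) ≡⟨ cong vertex (skip-above (m+n≮m a (suc e))) ⟩
        vertex (a + suc e + suc d)    ≡⟨ cong vertex (shifted (suc e)) ⟩
        vertex L                      ≡⟨ closed ⟩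
        vertex 0                      ≡⟨ skip-start vertex a d repeat ⟨
        vertex (skip a d 0)           ∎
    }
    where
      restStep : ∀ k → k < a + suc e →
                 LazyStep G (moves (skip a d k)) (vertex (skip a d k)) (vertex (skip a d (suc k)))
      restStep k k<a+e with k <? a | suc k <? a
      ... | yes k<a | yes _ = step k (beforeEnd k<a)
      ... | yes k<a | no 1+k≮a = subst (LazyStep G (moves k) (vertex k)) junction (step k (beforeEnd k<a))
        where
          -- the step into time a continues from time a + d + 1
          junction : vertex (suc k) ≡ vertex (suc k + suc d)
          junction with ≤∧≮⇒≡ k<a 1+k≮a
          ... | refl = repeat
      ... | no k≮a | yes 1+k<a = contradiction (<-trans (n<1+n k) 1+k<a) k≮a
      ... | no _ | no _ = step (k + suc d) (subst (k + suc d <_) (shifted (suc e)) (+-monoˡ-< (suc d) k<a+e))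

  after : Bool
  after = xorSum (λ k → moves (a + suc d + k)) (suc e)

  moveParity-split : moveParity ≡ (xorSum moves a xor ClosedLazyWalk.moveParity loop) xor after
  moveParity-split =
    trans (xorSum-+ moves (a + suc d) (suc e)) (cong (_xor after) (xorSum-+ moves a (suc d)))

  rest-moveParity : ClosedLazyWalk.moveParity rest ≡ xorSum moves a xor after
  rest-moveParity = trans (xorSum-+ (moves ∘′ skip a d) a (suc e))
    (cong₂ _xor_ (xorSum-cong a (λ k k<a → cong moves (skip-below k<a)))
                 (xorSum-cong (suc e) (λ k _ → cong moves (trans (skip-above (m+n≮m a k)) (shifted k)))))

  oddPiece : moveParity ≡ true → ∃[ L′ ] L′ < L × OddClosedLazyWalk G L′
  oddPiece odd with oddSummand (xorSum moves a) (ClosedLazyWalk.moveParity loop) after (trans (sym moveParity-split) odd)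
  ... | inj₁ oddLoop = suc d , ≤-<-trans (m≤n+m (suc d) a) (m<m+n (a + suc d) z<s) , loop , oddLoop
  ... | inj₂ oddRest = a + suc e , subst (a + suc e <_) (shifted (suc e)) (m<m+n (a + suc e) z<s)
                                 , rest , trans rest-moveParity oddRest

shorterOddWalk : ∀ {V : Set} {G : SimpleGraph V} {L} (W : OddClosedLazyWalk G L) {a b} → a < b → b < L →
                 ClosedLazyWalk.vertex (proj₁ W) a ≡ ClosedLazyWalk.vertex (proj₁ W) b →
                 ∃[ L′ ] L′ < L × OddClosedLazyWalk G L′
shorterOddWalk {G = G} {L} (w , odd) {a} {b} a<b b<L repeat
  with d , 1+a+d≡b ← m≤n⇒∃[o]m+o≡n a<b | e , 1+b+e≡L ← m≤n⇒∃[o]m+o≡n b<L = cutAt lengthL w odd repeatAt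
  where
    open ClosedLazyWalk w
    a+1+d≡b : a + suc d ≡ b
    a+1+d≡b = trans (+-suc a d) 1+a+d≡b
    lengthL : a + suc d + suc e ≡ L
    lengthL = trans (cong (_+ suc e) a+1+d≡b) (trans (+-suc b e) 1+b+e≡L)
    repeatAt : vertex a ≡ vertex (a + suc d)
    repeatAt = trans repeat (cong vertex (sym a+1+d≡b))
    -- Cut applies once the length has the shape a + (d + 1) + (e + 1).
    cutAt : ∀ {L} → a + suc d + suc e ≡ L → (w′ : ClosedLazyWalk G L) → ClosedLazyWalk.moveParity w′ ≡ true →
            ClosedLazyWalk.vertex w′ a ≡ ClosedLazyWalk.vertex w′ (a + suc d) → ∃[ L′ ] L′ < L × OddClosedLazyWalk G L′
    cutAt refl w′ odd′ r = Cut.oddPiece a d e w′ r odd′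

Repetition : {V : Set} → (ℕ → V) → ℕ → Set
Repetition f L = ∃[ b ] b < L × ∃[ a ] a < b × f a ≡ f b

repetition? : ∀ {V : Set} → DecidableEquality V → (f : ℕ → V) (L : ℕ) → Dec (Repetition f L)
repetition? _≟_ f = anyUpTo? (λ b → anyUpTo? (λ a → f a ≟ f b) b)

noRepetition⇒injective : ∀ {V : Set} {f : ℕ → V} {L} → ¬ Repetition f L → InjectiveBelow f L
noRepetition⇒injective noRep a b a<L b<L fa≡fb with <-cmp a b
... | tri< a<b _ _ = contradiction (b , b<L , a , a<b , fa≡fb) noRep
... | tri≈ _ a≡b _ = a≡b
... | tri> _ _ b<a = contradiction (a , a<L , b , b<a , sym fa≡fb) noRep

module _ {V : Set} {G : SimpleGraph V} where
  open ClosedLazyWalk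

  -- A closed lazy walk of length ≥ 2 without repeated vertices never stays
  -- put: a stay at time i would repeat vertex i at time i + 1 (or at time 0).
  noStays : ∀ {L} (w : ClosedLazyWalk G L) → 2 ≤ L → InjectiveBelow (vertex w) L →
            ∀ i → i < L → moves w i ≡ true
  noStays w 2≤L distinct i i<L with moves w i | step w i i<L
  ... | true | _ = refl
  ... | false | stay with m≤n⇒m<n∨m≡n i<L
  ...   | inj₁ 1+i<L = contradiction (sym (distinct i (suc i) i<L 1+i<L stay)) 1+n≢n
  ...   | inj₂ refl = contradiction (subst (λ j → 2 ≤ suc j) (distinct i 0 i<L z<s (trans stay (closed w))) 2≤L)
                                    λ { (s≤s ()) }

  alwaysMoves⇒closedWalk : ∀ {L} (w : ClosedLazyWalk G L) → (∀ i → i < L → moves w i ≡ true) → ClosedWalk G L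
  alwaysMoves⇒closedWalk w alwaysMoves = record
    { vertex = vertex w
    ; edge   = λ i i<L → subst (λ b → LazyStep G b (vertex w i) (vertex w (suc i))) (alwaysMoves i i<L) (step w i i<L)
    ; closed = closed w
    }

  simpleOddWalk⇒oddCycle : ∀ {L} (W : OddClosedLazyWalk G L) → InjectiveBelow (vertex (proj₁ W)) L → Odd L × Cycle G L
  simpleOddWalk⇒oddCycle {zero} (w , ()) _
  simpleOddWalk⇒oddCycle {1} (w , moves0) _ =
    ⊥-elim (irrefl G (subst (Adj G (vertex w 0)) (closed w) (subst (λ b → LazyStep G b _ _) moves0 (step w 0 z<s))))
  simpleOddWalk⇒oddCycle {L@(suc (suc m))} (w , odd) distinct =
    parity⇒Odd L oddLength , closedWalk⇒cycle (alwaysMoves⇒closedWalk w alwaysMoves) (3≤ m oddLength) distinct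
    where
      alwaysMoves : ∀ i → i < L → moves w i ≡ true
      alwaysMoves = noStays w (s≤s (s≤s z≤n)) distinct
      oddLength : parity L ≡ true
      oddLength = trans (sym (trans (xorSum-cong L alwaysMoves) (xorSum-true L))) odd
      3≤ : ∀ m → parity (suc (suc m)) ≡ true → 3 ≤ suc (suc m)
      3≤ zero ()
      3≤ (suc m) _ = s≤s (s≤s (s≤s z≤n))

  oddWalk⇒oddCycle : DecidableEquality V → ∀ L → OddClosedLazyWalk G L → OddCycleWithin G L
  oddWalk⇒oddCycle _≟_ = <-rec _ reduce
    where
      reduce : ∀ L → (∀ {L′} → L′ < L → OddClosedLazyWalk G L′ → OddCycleWithin G L′) →
               OddClosedLazyWalk G L → OddCycleWithin G L
      reduce L shorter W with repetition? _≟_ (vertex (proj₁ W)) L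
      ... | yes (b , b<L , a , a<b , repeat) with L′ , L′<L , W′ ← shorterOddWalk W a<b b<L repeat =
              let k , k≤L′ , rest = shorter L′<L W′ in k , ≤-trans k≤L′ (<⇒≤ L′<L) , rest
      ... | no noRep = L , ≤-refl , simpleOddWalk⇒oddCycle W (noRepetition⇒injective noRep)

module _ {V : Set} {G : SimpleGraph V} where
  productStep : ∀ {a b u v} → Adj (K₂□ G) (a , u) (b , v) → LazyStep G (not (a xor b)) u v
  productStep {true}  {true}  (inj₁ (t≢t , _)) = contradiction refl t≢t
  productStep {false} {false} (inj₁ (f≢f , _)) = contradiction refl f≢f
  productStep {true}  {false} (inj₁ (_ , u≡v)) = u≡v
  productStep {false} {true}  (inj₁ (_ , u≡v)) = u≡v
  productStep {a} {u = u} {v} (inj₂ (refl , uv)) =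
    subst (λ b → LazyStep G b u v) (sym (cong not (xor-same a))) uv

  project : ∀ {L} → ClosedWalk (K₂□ G) L → ClosedLazyWalk G L
  project W = record
    { vertex = proj₂ ∘′ vertex
    ; moves  = λ i → not (layer i xor layer (suc i))
    ; step   = λ i i<L → productStep (edge i i<L)
    ; closed = cong proj₂ closed
    }
    where
      open ClosedWalk W
      layer : ℕ → Bool
      layer = proj₁ ∘′ vertex

  -- The walk returns to its starting layer, so it changes layer an even
  -- number of times: the parity of its moves is the parity of its length.
  project-moveParity : ∀ {L} (W : ClosedWalk (K₂□ G) L) → ClosedLazyWalk.moveParity (project W) ≡ parity L
  project-moveParity {L} W = begin
    xorSum (λ i → not (layer i xor layer (suc i))) L ≡⟨ xorSum-not (λ i → layer i xor layer (suc i)) L ⟩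
    parity L xor xorSum (λ i → layer i xor layer (suc i)) L ≡⟨ cong (parity L xor_) (xorSum-telescope layer L) ⟩
    parity L xor (layer 0 xor layer L)               ≡⟨ cong (λ l → parity L xor (layer 0 xor l)) (cong proj₁ closed) ⟩
    parity L xor (layer 0 xor layer 0)               ≡⟨ cong (parity L xor_) (xor-same (layer 0)) ⟩
    parity L xor false                               ≡⟨ xor-identityʳ (parity L) ⟩
    parity L                                         ∎
    where
      open ClosedWalk W
      layer : ℕ → Bool
      layer = proj₁ ∘′ vertex

  productOddCycle⇒oddCycle : DecidableEquality V → ∀ {k} → Odd k → Cycle (K₂□ G) k → OddCycleWithin G k
  productOddCycle⇒oddCycle _≟_ {k} odd C =
    oddWalk⇒oddCycle _≟_ k (project W , trans (project-moveParity W) (Odd⇒parity odd))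
    where
      W : ClosedWalk (K₂□ G) k
      W = cycle⇒closedWalk C

  liftCycle : ∀ {k} → Cycle G k → Cycle (K₂□ G) k
  liftCycle C = record
    { m = m ; len = len ; len≥3 = len≥3
    ; vert = λ i → false , vert i
    ; distinct = λ e → distinct (cong proj₂ e)
    ; step = λ i → inj₂ (refl , step i)
    ; close = inj₂ (refl , close)
    }
    where open Cycle C

corollary1 : (n : ℕ) (G : SimpleGraph (Fin n)) (l : ℕ) → ShortestOddCycleLength G l → ShortestOddCycleLength (K₂□ G) l
corollary1 n G l (odd-l , C , shortest) = odd-l , liftCycle C , noShorter
  where
    noShorter : ∀ k → Odd k → Cycle (K₂□ G) k → l ≤ k
    noShorter k odd-k Ck with k′ , k′≤k , odd-k′ , C′ ← productOddCycle⇒oddCycle _≟ᶠ_ odd-k Ck =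
      ≤-trans (shortest k′ odd-k′ C′) k′≤k
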